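{- Let $m\ge1$ and let $W=(W_1,\ldots,W_m)$ be a word in the letters $\{X,Y,Z\}$, with associated element $\rho(W)=W_1^t\cdot W_2^t\cdots W_m^t\in\mathcal M^{\otimes(m+1)}$. The coefficient of $y\otimes n\otimes\cdots\otimes n\otimes y$ ($m+1$ factors, the first and last equal to $y$ and all others equal to $n$; for $m=1$ this is $y\otimes y$) in $\rho(W)$ is nonzero if and only if $W$ satisfies: (1) $W$ contains at least one $Y$; (2) $W_1\in\{X,Y\}$; (3) $W_m\in\{X,Y\}$; (4) the first letter of $W$ different from $X$ is $Y$, and the last letter of $W$ different from $X$ is $Y$ (i.e. $W$ begins with $k\ge0$ copies of $X$ followed by $Y$ and ends with $Y$ followed by $\ell\ge0$ copies of $X$); (5) the letters $Z$ and $Y$ occur alternately in $W$ (between any two occurrences of $Y$ there is a $Z$, and between any two occurrences of $Z$ there is a $Y$). Moreover, if $W$ satisfies these conditions, this coefficient equals $1$.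
   Context: Let $\mathcal M=\mathbb Z\langle y,n\rangle/(yn=ny=n,\ n^2=0,\ y^2=y)$; as an abelian group it is free with basis $1,y,n$, so for $r\ge1$, $\mathcal M^{\otimes r}$ (over $\mathbb Z$) is free with basis the simple tensors of elements of $\{1,y,n\}$, and "coefficient" refers to this basis. Define $X^t=y\otimes n+n\otimes y$, $Y^t=y\otimes y$, $Z^t=n\otimes n\in\mathcal M^{\otimes2}$. The chaining product $\mathcal M^{\otimes r}\times\mathcal M^{\otimes s}\to\mathcal M^{\otimes(r+s-1)}$ is the bilinear (associative) map $(a_1\otimes\cdots\otimes a_r)\cdot(b_1\otimes\cdots\otimes b_s)=a_1\otimes\cdots\otimes a_{r-1}\otimes(a_rb_1)\otimes b_2\otimes\cdots\otimes b_s$; the product $W_1^t\cdot W_2^t\cdots W_m^t$ is formed with it. -}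

module Defs where

open import Data.Nat using (ℕ; zero; suc; _+_)
open import Data.Integer using (ℤ; +_; _*_) renaming (_+_ to _+ℤ_)
import Data.Fin as Fin
open import Data.Fin using (Fin) renaming (_<_ to _<ᶠ_)
open import Data.Vec using (Vec; []; _∷_; lookup)
open import Data.List using (List; []; _∷_; concatMap)
open import Data.Maybe using (Maybe; just; nothing)
import Data.Maybe as Maybe
open import Data.Product using (_×_; _,_; ∃-syntax)
open import Data.Sum using (_⊎_)
open import Relation.Binary.PropositionalEquality using (_≡_; refl)
open import Relation.Nullary using (Dec; yes; no; ¬_)
import Data.Vec.Properties as VecP

-- Basis {1, y, n} of the algebra M = ℤ⟨y,n⟩/(yn = ny = n, n² = 0, y² = y)
data B : Set where
  one yB nB : B

_≟B_ : (a b : B) → Dec (a ≡ b)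
one ≟B one = yes refl
one ≟B yB = no λ ()
one ≟B nB = no λ ()
yB ≟B one = no λ ()
yB ≟B yB = yes refl
yB ≟B nB = no λ ()
nB ≟B one = no λ ()
nB ≟B yB = no λ ()
nB ≟B nB = yes refl

-- product of two basis elements: a basis element, or 0 (nothing)
mulB : B → B → Maybe B
mulB one b = just b
mulB a one = just a
mulB yB yB = just yB
mulB yB nB = just nB
mulB nB yB = just nB
mulB nB nB = nothing

-- Tensor r : elements of M^{⊗(r+1)} (free abelian group on basis tensors
-- Vec B (suc r)), represented as formal ℤ-linear combinations.
Tensor : ℕ → Set
Tensor r = List (ℤ × Vec B (suc r))

coeff : {r : ℕ} → Vec B (suc r) → Tensor r → ℤ
coeff v [] = + 0
coeff v ((c , w) ∷ t) with VecP.≡-dec _≟B_ v w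
... | yes _ = c +ℤ coeff v t
... | no _ = coeff v t

chainVec : {r s : ℕ} → Vec B (suc r) → Vec B (suc s) → Maybe (Vec B (suc (r + s)))
chainVec {zero} (a ∷ []) (b ∷ bs) = Maybe.map (λ c → c ∷ bs) (mulB a b)
chainVec {suc r} (a ∷ as) bs = Maybe.map (a ∷_) (chainVec as bs)

chain : {r s : ℕ} → Tensor r → Tensor s → Tensor (r + s)
chain t u = concatMap (λ p → concatMap (λ q → step p q) u) t
  where
  step : _ → _ → Tensor _
  step (c , v) (d , w) with chainVec v w
  ... | just x = (c * d , x) ∷ []
  ... | nothing = []

data Letter : Set where
  X Y Z : Letter

letterT : Letter → Tensor 1
letterT X = (+ 1 , yB ∷ nB ∷ []) ∷ (+ 1 , nB ∷ yB ∷ []) ∷ []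
letterT Y = (+ 1 , yB ∷ yB ∷ []) ∷ []
letterT Z = (+ 1 , nB ∷ nB ∷ []) ∷ []

ρ : {k : ℕ} → Vec Letter (suc k) → Tensor (suc k)
ρ (w ∷ []) = letterT w
ρ (w ∷ w′ ∷ ws) = chain (letterT w) (ρ (w′ ∷ ws))

middle : (k : ℕ) → Vec B (suc k)
middle zero = yB ∷ []
middle (suc k) = nB ∷ middle k

target : (k : ℕ) → Vec B (suc (suc k))
target k = yB ∷ middle k

module _ {k : ℕ} (W : Vec Letter (suc k)) where
  Cond1 : Set
  Cond1 = ∃[ i ] lookup W i ≡ Y

  Cond2 : Set
  Cond2 = lookup W Fin.zero ≡ X ⊎ lookup W Fin.zero ≡ Y

  Cond3 : Set
  Cond3 = lookup W (Fin.fromℕ k) ≡ X ⊎ lookup W (Fin.fromℕ k) ≡ Y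

  Cond4 : Set
  Cond4 = (∃[ i ] (lookup W i ≡ Y × (∀ j → j <ᶠ i → lookup W j ≡ X)))
        × (∃[ i ] (lookup W i ≡ Y × (∀ j → i <ᶠ j → lookup W j ≡ X)))

  Cond5 : Set
  Cond5 = (∀ i j → i <ᶠ j → lookup W i ≡ Y → lookup W j ≡ Y →
             ∃[ l ] (i <ᶠ l × l <ᶠ j × lookup W l ≡ Z))
        × (∀ i j → i <ᶠ j → lookup W i ≡ Z → lookup W j ≡ Z →
             ∃[ l ] (i <ᶠ l × l <ᶠ j × lookup W l ≡ Y))

  Conditions : Set
  Conditions = Cond1 × Cond2 × Cond3 × Cond4 × Cond5

-- Expanding W₁ᵗ · ρ(W₂⋯Wₘ), the coefficient of a ⊗ n ⊗ ⋯ ⊗ n ⊗ y (a = y or n) is 0 or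
-- a coefficient of the same shape in ρ(W₂⋯Wₘ), since y·n = n·y = n·1 = n while n·n = 0;
-- the coefficients with leading factor 1 that also arise vanish. So these coefficients
-- are 0 or 1 and are computed by a two-state automaton: in state awaitY (leading y) or
-- awaitZ (leading n), X keeps the state, Y moves awaitY to awaitZ, Z moves awaitZ to
-- awaitY, anything else rejects, and only awaitZ accepts the empty word. On the
-- combinatorial side, conditions (1)–(5) amount to "W contains a Y, every Z has a Y
-- before it and one after it, and any two Y's (Z's) are separated by a Z (Y)", a form
-- that sheds one letter at a time exactly as the automaton reads it.
module Submission where

open import Defs
open import Data.Bool using (Bool; true; false; T; if_then_else_)
open import Data.Empty using (⊥; ⊥-elim)
open import Data.Fin using (zero; suc; fromℕ; _<_)
open import Data.Fin.Properties using (<-cmp; ≤fromℕ)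
open import Data.Integer using (ℤ; +_; _*_) renaming (_+_ to _+ℤ_)
open import Data.Integer.Properties
  using (+-identityˡ; +-identityʳ; +-assoc; *-identityˡ; +-commutativeSemigroup)
open import Algebra.Properties.CommutativeSemigroup +-commutativeSemigroup using (interchange)
open import Data.List using ([]; _∷_; _++_; concatMap)
open import Data.List.Properties using (concatMap-cong; ++-identityʳ)
open import Data.Maybe using (Maybe; just; nothing; maybe′)
open import Data.Nat using (ℕ; suc; _+_; z<s; s<s; s<s⁻¹)
open import Data.Nat.Properties using (<⇒≱)
open import Data.Product using (_×_; _,_; ∃-syntax)
open import Data.Sum using (_⊎_; inj₁; inj₂)
import Data.Sum as Sum
open import Data.Unit using (tt)
open import Data.Vec using (Vec; []; _∷_; lookup)
open import Data.Vec.Properties using (∷-injectiveˡ; ∷-injectiveʳ; ≡-dec)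
open import Function using (_∘_; const)
open import Function.Bundles using (_⇔_; mk⇔; Equivalence)
open import Function.Construct.Composition using (_⇔-∘_)
open import Relation.Binary.Definitions using (tri<; tri≈; tri>)
open import Relation.Binary.PropositionalEquality
  using (_≡_; refl; sym; trans; cong; cong₂; subst; module ≡-Reasoning)
open import Relation.Nullary using (yes; no; ¬_; contradiction)

private variable
  m n : ℕ
  x l A C : Letter

coeff-[]-≢ : ∀ (v w : Vec B (suc m)) c → ¬ v ≡ w → coeff v ((c , w) ∷ []) ≡ + 0
coeff-[]-≢ v w c v≢w with ≡-dec _≟B_ v w
... | yes v≡w = ⊥-elim (v≢w v≡w)
... | no _    = refl

coeff-[]-prefix : ∀ a b c (v w : Vec B n) d →
                  coeff (a ∷ b ∷ v) ((+ 1 * d , a ∷ b ∷ w) ∷ []) ≡ coeff (c ∷ v) ((d , c ∷ w) ∷ [])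
coeff-[]-prefix a b c v w d with ≡-dec _≟B_ (a ∷ b ∷ v) (a ∷ b ∷ w) | ≡-dec _≟B_ (c ∷ v) (c ∷ w)
... | yes _  | yes _  = cong (_+ℤ + 0) (*-identityˡ d)
... | yes eq | no ¬eq = ⊥-elim (¬eq (cong (c ∷_) (∷-injectiveʳ (∷-injectiveʳ eq))))
... | no ¬eq | yes eq = ⊥-elim (¬eq (cong (λ u → a ∷ b ∷ u) (∷-injectiveʳ eq)))
... | no _   | no _   = refl

coeff-∷ : ∀ (v : Vec B (suc m)) q t → coeff v (q ∷ t) ≡ coeff v (q ∷ []) +ℤ coeff v t
coeff-∷ v (c , w) t with ≡-dec _≟B_ v w
... | yes _ = cong (_+ℤ coeff v t) (sym (+-identityʳ c))
... | no _  = sym (+-identityˡ (coeff v t))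

coeff-++ : ∀ (v : Vec B (suc m)) t t′ → coeff v (t ++ t′) ≡ coeff v t +ℤ coeff v t′
coeff-++ v []      t′ = sym (+-identityˡ (coeff v t′))
coeff-++ v (q ∷ t) t′ = begin
  coeff v (q ∷ t ++ t′)                          ≡⟨ coeff-∷ v q (t ++ t′) ⟩
  coeff v (q ∷ []) +ℤ coeff v (t ++ t′)          ≡⟨ cong (coeff v (q ∷ []) +ℤ_) (coeff-++ v t t′) ⟩
  coeff v (q ∷ []) +ℤ (coeff v t +ℤ coeff v t′)  ≡⟨ +-assoc (coeff v (q ∷ [])) (coeff v t) (coeff v t′) ⟨
  (coeff v (q ∷ []) +ℤ coeff v t) +ℤ coeff v t′  ≡⟨ cong (_+ℤ coeff v t′) (coeff-∷ v q t) ⟨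
  coeff v (q ∷ t) +ℤ coeff v t′                  ∎
  where open ≡-Reasoning

_·_ : ℤ × Vec B (suc m) → ℤ × Vec B (suc n) → Tensor (m + n)
(c , x) · (d , w) = maybe′ (λ z → (c * d , z) ∷ []) [] (chainVec x w)

_⊙_ : ℤ × Vec B (suc m) → Tensor n → Tensor (m + n)
p ⊙ u = concatMap (p ·_) u

⟨_⊗_⟩ : B → B → ℤ × Vec B 2
⟨ a ⊗ b ⟩ = + 1 , a ∷ b ∷ []

by-first-factor : {P : ℤ × Vec B (suc n) → Set} →
                  (∀ {d ws} → P (d , one ∷ ws)) → (∀ {d ws} → P (d , yB ∷ ws)) →
                  (∀ {d ws} → P (d , nB ∷ ws)) → ∀ q → P q
by-first-factor p₁ pʸ pⁿ (d , one ∷ ws) = p₁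
by-first-factor p₁ pʸ pⁿ (d , yB ∷ ws)  = pʸ
by-first-factor p₁ pʸ pⁿ (d , nB ∷ ws)  = pⁿ

-- The term product inside chain is a local function that only computes once both basis
-- tensors are known, so chain is compared with _⊙_ letter by letter.
chain-X : ∀ (u : Tensor n) → chain (letterT X) u ≡ ⟨ yB ⊗ nB ⟩ ⊙ u ++ ⟨ nB ⊗ yB ⟩ ⊙ u
chain-X u = cong₂ _++_
  (concatMap-cong (by-first-factor refl refl refl) u)
  (trans (cong (_++ []) (concatMap-cong (by-first-factor refl refl refl) u)) (++-identityʳ _))

chain-Y : ∀ (u : Tensor n) → chain (letterT Y) u ≡ ⟨ yB ⊗ yB ⟩ ⊙ u
chain-Y u = trans (cong (_++ []) (concatMap-cong (by-first-factor refl refl refl) u)) (++-identityʳ _)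

chain-Z : ∀ (u : Tensor n) → chain (letterT Z) u ≡ ⟨ nB ⊗ nB ⟩ ⊙ u
chain-Z u = trans (cong (_++ []) (concatMap-cong (by-first-factor refl refl refl) u)) (++-identityʳ _)

coeff-·-≢ : ∀ {a a′ b} {v : Vec B (suc n)} → ¬ a′ ≡ a → ∀ q → coeff (a′ ∷ v) (⟨ a ⊗ b ⟩ · q) ≡ + 0
coeff-·-≢ {a = a} {a′} {b} {v} a′≢a (d , z ∷ ws) with mulB b z
... | nothing = refl
... | just c  = coeff-[]-≢ (a′ ∷ v) (a ∷ c ∷ ws) _ (a′≢a ∘ ∷-injectiveˡ)

coeff-⊙-≢ : ∀ {a a′ b} {v : Vec B (suc n)} → ¬ a′ ≡ a → ∀ u → coeff (a′ ∷ v) (⟨ a ⊗ b ⟩ ⊙ u) ≡ + 0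
coeff-⊙-≢                      a′≢a []      = refl
coeff-⊙-≢ {a = a} {a′} {b} {v} a′≢a (q ∷ u) =
  trans (coeff-++ (a′ ∷ v) (⟨ a ⊗ b ⟩ · q) (⟨ a ⊗ b ⟩ ⊙ u))
        (cong₂ _+ℤ_ (coeff-·-≢ a′≢a q) (coeff-⊙-≢ a′≢a u))

module _ {a : B} {v : Vec B n} where

  coeff-·-y : ∀ q → coeff (a ∷ nB ∷ v) (⟨ a ⊗ yB ⟩ · q) ≡ coeff (nB ∷ v) (q ∷ [])
  coeff-·-y (d , one ∷ ws) = coeff-[]-≢ (a ∷ nB ∷ v) (a ∷ yB ∷ ws) _ λ ()
  coeff-·-y (d , yB ∷ ws)  = coeff-[]-≢ (a ∷ nB ∷ v) (a ∷ yB ∷ ws) _ λ ()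
  coeff-·-y (d , nB ∷ ws)  = coeff-[]-prefix a nB nB v ws d

  coeff-·-n : ∀ q → coeff (a ∷ nB ∷ v) (⟨ a ⊗ nB ⟩ · q)
                    ≡ coeff (one ∷ v) (q ∷ []) +ℤ coeff (yB ∷ v) (q ∷ [])
  coeff-·-n (d , one ∷ ws) = trans (coeff-[]-prefix a nB one v ws d) (sym (+-identityʳ _))
  coeff-·-n (d , yB ∷ ws)  = trans (coeff-[]-prefix a nB yB v ws d) (sym (+-identityˡ _))
  coeff-·-n (d , nB ∷ ws)  = refl

  coeff-⊙-y : ∀ u → coeff (a ∷ nB ∷ v) (⟨ a ⊗ yB ⟩ ⊙ u) ≡ coeff (nB ∷ v) u
  coeff-⊙-y []      = refl
  coeff-⊙-y (q ∷ u) = begin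
    coeff w (⟨ a ⊗ yB ⟩ · q ++ ⟨ a ⊗ yB ⟩ ⊙ u)           ≡⟨ coeff-++ w (⟨ a ⊗ yB ⟩ · q) (⟨ a ⊗ yB ⟩ ⊙ u) ⟩
    coeff w (⟨ a ⊗ yB ⟩ · q) +ℤ coeff w (⟨ a ⊗ yB ⟩ ⊙ u)  ≡⟨ cong₂ _+ℤ_ (coeff-·-y q) (coeff-⊙-y u) ⟩
    coeff (nB ∷ v) (q ∷ []) +ℤ coeff (nB ∷ v) u           ≡⟨ coeff-∷ (nB ∷ v) q u ⟨
    coeff (nB ∷ v) (q ∷ u)                                ∎
    where open ≡-Reasoning
          w = a ∷ nB ∷ v

  coeff-⊙-n : ∀ u → coeff (a ∷ nB ∷ v) (⟨ a ⊗ nB ⟩ ⊙ u) ≡ coeff (one ∷ v) u +ℤ coeff (yB ∷ v) u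
  coeff-⊙-n []      = refl
  coeff-⊙-n (q ∷ u) = begin
    coeff w (⟨ a ⊗ nB ⟩ · q ++ ⟨ a ⊗ nB ⟩ ⊙ u)           ≡⟨ coeff-++ w (⟨ a ⊗ nB ⟩ · q) (⟨ a ⊗ nB ⟩ ⊙ u) ⟩
    coeff w (⟨ a ⊗ nB ⟩ · q) +ℤ coeff w (⟨ a ⊗ nB ⟩ ⊙ u)  ≡⟨ cong₂ _+ℤ_ (coeff-·-n q) (coeff-⊙-n u) ⟩
    (c₁ (q ∷ []) +ℤ cʸ (q ∷ [])) +ℤ (c₁ u +ℤ cʸ u)        ≡⟨ interchange (c₁ (q ∷ [])) (cʸ (q ∷ [])) (c₁ u) (cʸ u) ⟩
    (c₁ (q ∷ []) +ℤ c₁ u) +ℤ (cʸ (q ∷ []) +ℤ cʸ u)        ≡⟨ cong₂ _+ℤ_ (coeff-∷ (one ∷ v) q u) (coeff-∷ (yB ∷ v) q u) ⟨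
    c₁ (q ∷ u) +ℤ cʸ (q ∷ u)                              ∎
    where open ≡-Reasoning
          w = a ∷ nB ∷ v
          c₁ cʸ : Tensor n → ℤ
          c₁ = coeff (one ∷ v)
          cʸ = coeff (yB ∷ v)

  coeff-⊙-n-one≡0 : ∀ u → coeff (one ∷ v) u ≡ + 0 →
                    coeff (a ∷ nB ∷ v) (⟨ a ⊗ nB ⟩ ⊙ u) ≡ coeff (yB ∷ v) u
  coeff-⊙-n-one≡0 u one≡0 =
    trans (coeff-⊙-n u) (trans (cong (_+ℤ coeff (yB ∷ v) u) one≡0) (+-identityˡ _))

coeff-chain-X : ∀ (w : Vec B (suc (suc n))) u →
                coeff w (chain (letterT X) u) ≡ coeff w (⟨ yB ⊗ nB ⟩ ⊙ u) +ℤ coeff w (⟨ nB ⊗ yB ⟩ ⊙ u)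
coeff-chain-X w u = trans (cong (coeff w) (chain-X u)) (coeff-++ w (⟨ yB ⊗ nB ⟩ ⊙ u) (⟨ nB ⊗ yB ⟩ ⊙ u))

coeff-one-chain : ∀ L {v : Vec B (suc n)} (u : Tensor n) →
                  coeff (one ∷ v) (chain (letterT L) u) ≡ + 0
coeff-one-chain X {v} u =
  trans (coeff-chain-X (one ∷ v) u) (cong₂ _+ℤ_ (coeff-⊙-≢ (λ ()) u) (coeff-⊙-≢ (λ ()) u))
coeff-one-chain Y {v} u = trans (cong (coeff (one ∷ v)) (chain-Y u)) (coeff-⊙-≢ (λ ()) u)
coeff-one-chain Z {v} u = trans (cong (coeff (one ∷ v)) (chain-Z u)) (coeff-⊙-≢ (λ ()) u)

data State : Set where
  awaitY awaitZ : State

leading : State → B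
leading awaitY = yB
leading awaitZ = nB

δ : State → Letter → Maybe State
δ s      X = just s
δ awaitY Y = just awaitZ
δ awaitZ Y = nothing
δ awaitY Z = nothing
δ awaitZ Z = just awaitY

accepting : State → Bool
accepting awaitY = false
accepting awaitZ = true

accepts : State → Vec Letter n → Bool
accepts s []      = accepting s
accepts s (L ∷ W) = maybe′ (λ t → accepts t W) false (δ s L)

coeff-chain-letter : ∀ s L {v : Vec B n} (u : Tensor n) → coeff (one ∷ v) u ≡ + 0 →
                     coeff (leading s ∷ nB ∷ v) (chain (letterT L) u)
                     ≡ maybe′ (λ t → coeff (leading t ∷ v) u) (+ 0) (δ s L)
coeff-chain-letter awaitY X u one≡0 = trans (coeff-chain-X _ u)
  (trans (cong₂ _+ℤ_ (coeff-⊙-n-one≡0 u one≡0) (coeff-⊙-≢ (λ ()) u)) (+-identityʳ _))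
coeff-chain-letter awaitZ X u _     = trans (coeff-chain-X _ u)
  (trans (cong₂ _+ℤ_ (coeff-⊙-≢ (λ ()) u) (coeff-⊙-y u)) (+-identityˡ _))
coeff-chain-letter awaitY Y u _     = trans (cong (coeff _) (chain-Y u)) (coeff-⊙-y u)
coeff-chain-letter awaitZ Y u _     = trans (cong (coeff _) (chain-Y u)) (coeff-⊙-≢ (λ ()) u)
coeff-chain-letter awaitY Z u _     = trans (cong (coeff _) (chain-Z u)) (coeff-⊙-≢ (λ ()) u)
coeff-chain-letter awaitZ Z u one≡0 = trans (cong (coeff _) (chain-Z u)) (coeff-⊙-n-one≡0 u one≡0)

coeff-one-ρ : ∀ {k} (W : Vec Letter (suc k)) → coeff (one ∷ middle k) (ρ W) ≡ + 0
coeff-one-ρ (X ∷ [])        = refl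
coeff-one-ρ (Y ∷ [])        = refl
coeff-one-ρ (Z ∷ [])        = refl
coeff-one-ρ (L ∷ W@(_ ∷ _)) = coeff-one-chain L (ρ W)

coeff-ρ : ∀ {k} s (W : Vec Letter (suc k)) →
          coeff (leading s ∷ middle k) (ρ W) ≡ (if accepts s W then + 1 else + 0)
coeff-ρ awaitY (X ∷ []) = refl
coeff-ρ awaitY (Y ∷ []) = refl
coeff-ρ awaitY (Z ∷ []) = refl
coeff-ρ awaitZ (X ∷ []) = refl
coeff-ρ awaitZ (Y ∷ []) = refl
coeff-ρ awaitZ (Z ∷ []) = refl
coeff-ρ s (L ∷ W@(_ ∷ _)) with δ s L | coeff-chain-letter s L (ρ W) (coeff-one-ρ W)
... | just t  | step = trans step (coeff-ρ t W)
... | nothing | step = step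

Occurs : Letter → Vec Letter n → Set
Occurs l W = ∃[ i ] lookup W i ≡ l

Preceded : Letter → Letter → Vec Letter n → Set
Preceded A C W = ∀ i → lookup W i ≡ A → ∃[ j ] (j < i × lookup W j ≡ C)

Followed : Letter → Letter → Vec Letter n → Set
Followed A C W = ∀ i → lookup W i ≡ A → ∃[ j ] (i < j × lookup W j ≡ C)

Separated : Letter → Letter → Vec Letter n → Set
Separated A C W = ∀ i j → i < j → lookup W i ≡ A → lookup W j ≡ A →
                  ∃[ k ] (i < k × k < j × lookup W k ≡ C)

module _ {W : Vec Letter n} where

  occurs-∷ : Occurs l W → Occurs l (x ∷ W)
  occurs-∷ (i , e) = suc i , e

  occurs-tail : ¬ x ≡ l → Occurs l (x ∷ W) → Occurs l W
  occurs-tail x≢l (zero , e)  = contradiction e x≢l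
  occurs-tail x≢l (suc i , e) = i , e

  preceded-∷ : ¬ x ≡ A → Preceded A C W → Preceded A C (x ∷ W)
  preceded-∷ x≢A p zero    e = contradiction e x≢A
  preceded-∷ x≢A p (suc i) e with p i e
  ... | j , j<i , e′ = suc j , s<s j<i , e′

  preceded-here : ¬ A ≡ C → Preceded A C (C ∷ W)
  preceded-here A≢C zero    e = contradiction (sym e) A≢C
  preceded-here A≢C (suc i) _ = zero , z<s , refl

  preceded-tail : ¬ x ≡ C → Preceded A C (x ∷ W) → Preceded A C W
  preceded-tail x≢C p i e with p (suc i) e
  ... | zero  , _   , e′ = contradiction e′ x≢C
  ... | suc j , j<i , e′ = j , s<s⁻¹ j<i , e′

  ¬preceded-head : ¬ Preceded A C (A ∷ W)
  ¬preceded-head p with p zero refl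
  ... | _ , () , _

  followed-∷ : (x ≡ A → Occurs C W) → Followed A C W → Followed A C (x ∷ W)
  followed-∷ occ f zero e with occ e
  ... | j , e′ = suc j , z<s , e′
  followed-∷ occ f (suc i) e with f i e
  ... | j , i<j , e′ = suc j , s<s i<j , e′

  followed-tail : Followed A C (x ∷ W) → Followed A C W
  followed-tail f i e with f (suc i) e
  ... | suc j , i<j , e′ = j , s<s⁻¹ i<j , e′

  followed-head : Followed A C (A ∷ W) → Occurs C W
  followed-head f with f zero refl
  ... | suc j , _ , e = j , e

  separated-∷ : (x ≡ A → Preceded A C W) → Separated A C W → Separated A C (x ∷ W)
  separated-∷ pre s zero    (suc j) _   e e′ with pre e j e′
  ... | k , k<j , e″ = suc k , z<s , s<s k<j , e″
  separated-∷ pre s (suc i) (suc j) i<j e e′ with s i j (s<s⁻¹ i<j) e e′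
  ... | k , i<k , k<j , e″ = suc k , s<s i<k , s<s k<j , e″

  separated-tail : Separated A C (x ∷ W) → Separated A C W
  separated-tail s i j i<j e e′ with s (suc i) (suc j) (s<s i<j) e e′
  ... | suc k , i<k , k<j , e″ = k , s<s⁻¹ i<k , s<s⁻¹ k<j , e″

  separated-head : Separated A C (A ∷ W) → Preceded A C W
  separated-head s j e with s zero (suc j) z<s refl e
  ... | suc k , _ , k<j , e′ = k , s<s⁻¹ k<j , e′

Valid : State → Vec Letter n → Set
Valid awaitY W = Occurs Y W × Preceded Z Y W × Followed Z Y W × Separated Y Z W × Separated Z Y W
Valid awaitZ W = Preceded Y Z W × Followed Z Y W × Separated Y Z W × Separated Z Y W

valid-[] : ∀ s → Valid s [] ⇔ T (accepting s)
valid-[] awaitY = mk⇔ (λ { ((() , _) , _) }) λ ()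
valid-[] awaitZ = mk⇔ _ (λ _ → (λ ()) , (λ ()) , (λ ()) , (λ ()))

valid-∷ : ∀ s L {W : Vec Letter n} → Valid s (L ∷ W) ⇔ maybe′ (λ t → Valid t W) ⊥ (δ s L)
valid-∷ awaitY X = mk⇔
  (λ (o , p , f , sʸ , sᶻ) → occurs-tail (λ ()) o , preceded-tail (λ ()) p , followed-tail f ,
                             separated-tail sʸ , separated-tail sᶻ)
  (λ (o , p , f , sʸ , sᶻ) → occurs-∷ o , preceded-∷ (λ ()) p , followed-∷ (λ ()) f ,
                             separated-∷ (λ ()) sʸ , separated-∷ (λ ()) sᶻ)
valid-∷ awaitZ X = mk⇔
  (λ (p , f , sʸ , sᶻ) → preceded-tail (λ ()) p , followed-tail f , separated-tail sʸ , separated-tail sᶻ)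
  (λ (p , f , sʸ , sᶻ) → preceded-∷ (λ ()) p , followed-∷ (λ ()) f , separated-∷ (λ ()) sʸ , separated-∷ (λ ()) sᶻ)
valid-∷ awaitY Y = mk⇔
  (λ (_ , _ , f , sʸ , sᶻ) → separated-head sʸ , followed-tail f , separated-tail sʸ , separated-tail sᶻ)
  (λ (p , f , sʸ , sᶻ) → (zero , refl) , preceded-here (λ ()) , followed-∷ (λ ()) f ,
                         separated-∷ (const p) sʸ , separated-∷ (λ ()) sᶻ)
valid-∷ awaitZ Y = mk⇔ (λ (p , _) → ¬preceded-head p) λ ()
valid-∷ awaitY Z = mk⇔ (λ (_ , p , _) → ¬preceded-head p) λ ()
valid-∷ awaitZ Z = mk⇔
  (λ (_ , f , sʸ , sᶻ) → followed-head f , separated-head sᶻ , followed-tail f ,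
                         separated-tail sʸ , separated-tail sᶻ)
  (λ (o , p , f , sʸ , sᶻ) → preceded-here (λ ()) , followed-∷ (const o) f ,
                             separated-∷ (λ ()) sʸ , separated-∷ (const p) sᶻ)

valid⇔accepts : ∀ s (W : Vec Letter n) → Valid s W ⇔ T (accepts s W)
valid⇔accepts s []      = valid-[] s
valid⇔accepts s (L ∷ W) with δ s L | valid-∷ s L {W}
... | just t  | valid-∷≡ = valid⇔accepts t W ⇔-∘ valid-∷≡
... | nothing | valid-∷≡ = valid-∷≡

AllX : Vec Letter n → Set
AllX W = ∀ i → lookup W i ≡ X

FirstNonX : Letter → Vec Letter n → Set
FirstNonX l W = ∃[ i ] (lookup W i ≡ l × (∀ j → j < i → lookup W j ≡ X))

LastNonX : Letter → Vec Letter n → Set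
LastNonX l W = ∃[ i ] (lookup W i ≡ l × (∀ j → i < j → lookup W j ≡ X))

firstNonX : (W : Vec Letter n) → AllX W ⊎ FirstNonX Y W ⊎ FirstNonX Z W
firstNonX []      = inj₁ λ ()
firstNonX (X ∷ W) = Sum.map allX-∷ (Sum.map later later) (firstNonX W)
  where
  allX-∷ : AllX W → AllX (X ∷ W)
  allX-∷ allX zero    = refl
  allX-∷ allX (suc i) = allX i
  later : FirstNonX l W → FirstNonX l (X ∷ W)
  later (i , e , before) = suc i , e , λ { zero _ → refl ; (suc j) j<i → before j (s<s⁻¹ j<i) }
firstNonX (Y ∷ W) = inj₂ (inj₁ (zero , refl , λ _ ()))
firstNonX (Z ∷ W) = inj₂ (inj₂ (zero , refl , λ _ ()))

lastNonX : (W : Vec Letter n) → AllX W ⊎ LastNonX Y W ⊎ LastNonX Z W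
lastNonX []      = inj₁ λ ()
lastNonX (x ∷ W) with lastNonX W
... | inj₂ last = inj₂ (Sum.map earlier earlier last)
  where
  earlier : LastNonX l W → LastNonX l (x ∷ W)
  earlier (i , e , after) = suc i , e , λ { (suc j) i<j → after j (s<s⁻¹ i<j) }
... | inj₁ allX with x
...   | X = inj₁ λ { zero → refl ; (suc i) → allX i }
...   | Y = inj₂ (inj₁ (zero , refl , λ { (suc j) _ → allX j }))
...   | Z = inj₂ (inj₂ (zero , refl , λ { (suc j) _ → allX j }))

module _ {W : Vec Letter n} where

  firstNonX⇒preceded : ¬ A ≡ X → ¬ A ≡ C → FirstNonX C W → Preceded A C W
  firstNonX⇒preceded A≢X A≢C (i , e , before) j e′ with <-cmp j i
  ... | tri< j<i _ _  = contradiction (trans (sym e′) (before j j<i)) A≢X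
  ... | tri≈ _ refl _ = contradiction (trans (sym e′) e) A≢C
  ... | tri> _ _ i<j  = i , i<j , e

  lastNonX⇒followed : ¬ A ≡ X → ¬ A ≡ C → LastNonX C W → Followed A C W
  lastNonX⇒followed A≢X A≢C (i , e , after) j e′ with <-cmp j i
  ... | tri< j<i _ _  = i , j<i , e
  ... | tri≈ _ refl _ = contradiction (trans (sym e′) e) A≢C
  ... | tri> _ _ i<j  = contradiction (trans (sym e′) (after j i<j)) A≢X

  preceded⇒firstNonX : Occurs Y W → Preceded Z Y W → FirstNonX Y W
  preceded⇒firstNonX (i , e) pre with firstNonX W
  ... | inj₁ allX                     = contradiction (trans (sym (allX i)) e) λ ()
  ... | inj₂ (inj₁ first)             = first
  ... | inj₂ (inj₂ (i , e′ , before)) with pre i e′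
  ...   | j , j<i , e″ = contradiction (trans (sym (before j j<i)) e″) λ ()

  followed⇒lastNonX : Occurs Y W → Followed Z Y W → LastNonX Y W
  followed⇒lastNonX (i , e) fol with lastNonX W
  ... | inj₁ allX                    = contradiction (trans (sym (allX i)) e) λ ()
  ... | inj₂ (inj₁ last)             = last
  ... | inj₂ (inj₂ (i , e′ , after)) with fol i e′
  ...   | j , i<j , e″ = contradiction (trans (sym (after j i<j)) e″) λ ()

firstNonX⇒head : {W : Vec Letter (suc n)} → FirstNonX l W → lookup W zero ≡ X ⊎ lookup W zero ≡ l
firstNonX⇒head (zero  , e , _)      = inj₂ e
firstNonX⇒head (suc i , _ , before) = inj₁ (before zero z<s)

lastNonX⇒last : {W : Vec Letter (suc n)} → LastNonX l W → lookup W (fromℕ n) ≡ X ⊎ lookup W (fromℕ n) ≡ l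
lastNonX⇒last {n = n} (i , e , after) with <-cmp i (fromℕ n)
... | tri< i<last _ _ = inj₁ (after (fromℕ n) i<last)
... | tri≈ _ refl _   = inj₂ e
... | tri> _ _ last<i = contradiction (≤fromℕ i) (<⇒≱ last<i)

conditions⇔valid : ∀ {k} (W : Vec Letter (suc k)) → Conditions W ⇔ Valid awaitY W
conditions⇔valid W = mk⇔
  (λ (occ , _ , _ , (first , last) , sʸ , sᶻ) →
     occ , firstNonX⇒preceded {W = W} (λ ()) (λ ()) first ,
     lastNonX⇒followed {W = W} (λ ()) (λ ()) last , sʸ , sᶻ)
  (λ (occ , pre , fol , sʸ , sᶻ) →
     let first = preceded⇒firstNonX {W = W} occ pre
         last  = followed⇒lastNonX {W = W} occ fol
     in occ , firstNonX⇒head {W = W} first , lastNonX⇒last {W = W} last , (first , last) , sʸ , sᶻ)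

lemma5p10 : (k : ℕ) (W : Vec Letter (suc k)) →
    ((¬ coeff (target k) (ρ W) ≡ + 0 → Conditions W)
     × (Conditions W → ¬ coeff (target k) (ρ W) ≡ + 0))
    × (Conditions W → coeff (target k) (ρ W) ≡ + 1)
lemma5p10 k W
  with accepts awaitY W | coeff-ρ awaitY W | valid⇔accepts awaitY W ⇔-∘ conditions⇔valid W
... | true  | coeff≡1 | conditions⇔⊤ =
  (const (Equivalence.from conditions⇔⊤ tt) , const (subst (λ c → ¬ c ≡ + 0) (sym coeff≡1) λ ())) ,
  const coeff≡1
... | false | coeff≡0 | conditions⇔⊥ =
  (contradiction coeff≡0 , ⊥-elim ∘ Equivalence.to conditions⇔⊥) , ⊥-elim ∘ Equivalence.to conditions⇔⊥
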